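{- For integers $m\ge 5$ odd and $n\ge 3$, $\chi_{ld}(C_m[\overline{K_n}])=3$.
   Context: For a graph $G=(V,E)$ of order $N$ and a bijection $f\colon V\to\{1,\dots,N\}$, the weight of a vertex $u$ is $w(u)=\sum_{x\in N(u)}f(x)$, where $N(u)$ is the open neighborhood of $u$. The bijection $f$ is a local distance antimagic labeling if $w(u)\neq w(v)$ for every edge $uv$. $\chi_{ld}(G)$ is the minimum number of distinct weights over all local distance antimagic labelings of $G$. $C_m$ is the cycle on $m$ vertices; $\overline{K_n}$ is the edgeless graph on $n$ vertices. The lexicographic product $G[H]$ has vertex set $V(G)\times V(H)$, with $(g,h)$ adjacent to $(g',h')$ iff $gg'\in E(G)$, or $g=g'$ and $hh'\in E(H)$. -}

module Defs where

open import Data.Nat using (ℕ; zero; suc; _+_; _*_; _≤_; _≡ᵇ_)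
open import Data.Nat.Properties using (_≟_)
open import Data.Bool using (Bool; true; false; _∨_; _∧_; if_then_else_)
open import Data.Fin using (Fin; toℕ; quotRem)
open import Data.Fin.Properties as FinP using ()
open import Data.Product using (Σ; ∃; _×_; _,_; proj₁; proj₂)
open import Data.List using (List; length; map; allFin; deduplicate)
open import Data.Nat.ListAction using (sum)
open import Function.Bundles using (_⤖_; Bijection)
open import Relation.Binary.PropositionalEquality using (_≡_; _≢_)

cycleAdj : (m : ℕ) → Fin m → Fin m → Bool
cycleAdj m i j =
  (toℕ j ≡ᵇ suc (toℕ i)) ∨ (toℕ i ≡ᵇ suc (toℕ j))
  ∨ ((toℕ i ≡ᵇ 0) ∧ (suc (toℕ j) ≡ᵇ m))
  ∨ ((toℕ j ≡ᵇ 0) ∧ (suc (toℕ i) ≡ᵇ m))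

emptyAdj : (n : ℕ) → Fin n → Fin n → Bool
emptyAdj n _ _ = false

_=ᶠ_ : ∀ {m} → Fin m → Fin m → Bool
i =ᶠ j = toℕ i ≡ᵇ toℕ j

-- Raw adjacency of the lexicographic product G[H] on Fin (m * n);
-- a vertex x corresponds to the pair (g , h) with quotRem n x = (h , g).
lexAdj : ∀ {m n} → (Fin m → Fin m → Bool) → (Fin n → Fin n → Bool)
       → Fin (m * n) → Fin (m * n) → Bool
lexAdj {m} {n} G H x y =
  G (proj₂ (quotRem {m} n x)) (proj₂ (quotRem {m} n y))
  ∨ ((proj₂ (quotRem {m} n x) =ᶠ proj₂ (quotRem {m} n y))
     ∧ H (proj₁ (quotRem {m} n x)) (proj₁ (quotRem {m} n y)))

cycleLexEmpty : (m n : ℕ) → Fin (m * n) → Fin (m * n) → Bool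
cycleLexEmpty m n = lexAdj (cycleAdj m) (emptyAdj n)

-- Labelings: bijections f : V → {1,…,N}; we encode {1,…,N} as Fin N via k ↦ k+1.
Labeling : ℕ → Set
Labeling N = Fin N ⤖ Fin N

label : ∀ {N} → Labeling N → Fin N → ℕ
label f v = suc (toℕ (Bijection.to f v))

weight : ∀ {N} → (Fin N → Fin N → Bool) → Labeling N → Fin N → ℕ
weight {N} A f u = sum (map (λ v → if A u v then label f v else 0) (allFin N))

IsLDA : ∀ {N} → (Fin N → Fin N → Bool) → Labeling N → Set
IsLDA A f = ∀ u v → A u v ≡ true → weight A f u ≢ weight A f v

numWeights : ∀ {N} → (Fin N → Fin N → Bool) → Labeling N → ℕ
numWeights {N} A f = length (deduplicate _≟_ (map (weight A f) (allFin N)))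

ChiLdEq : ∀ {N} → (Fin N → Fin N → Bool) → ℕ → Set
ChiLdEq A k =
  (Σ (Labeling _) λ f → IsLDA A f × numWeights A f ≡ k)
  × (∀ f → IsLDA A f → k ≤ numWeights A f)

-- The weights of a local distance antimagic labeling properly colour the graph, and the
-- layers of C_m[K̄_n] contain an odd cycle, so at least three weights occur.
--
-- Conversely, a vertex in layer g is adjacent exactly to the vertices of layers g ∓ 1, so
-- its weight is S(g-1) + S(g+1), where S(g) is the sum of the labels in layer g. Give the
-- vertex in layer g and slot h the label 1 + h·m + ρ_h(g), where ρ_0, …, ρ_{n-1} permute
-- {0, …, m-1}. Take for ρ a Kotzig array (rows are permutations, column sums are constant;
-- one exists for odd m and any number ≥ 2 of rows) whose first row is the identity, and
-- replace that row by the involution exchanging 4i+1 and 4i+2. Then S(g) = K + e(g) for a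
-- constant K and e periodic with pattern 1,2,0,1, so e(g-1) + e(g+1) is 1 at odd g, 3 at
-- even g away from the wrap-around edge, and 2 and 3 (in some order) at its ends 0 and m-1:
-- adjacent layers get different weights, and exactly three weights occur.

{-# OPTIONS --safe #-}
module Submission where

open import Defs
open import Data.Bool using (Bool; true; false; _∨_; _∧_; if_then_else_)
open import Data.Bool.Properties using (T-∨; T-∧; T-≡; ∨-zeroʳ; ∨-identityʳ; ∧-zeroʳ)
open import Data.Fin as Fin using (Fin; toℕ; fromℕ<; punchOut; quotRem; remQuot; combine)
open import Data.Fin.Properties
  using (toℕ<n; toℕ-fromℕ<; toℕ-injective; any?; punchOut-injective; <⇒notInjective;
         toℕ-combine; combine-remQuot)
open import Data.List using (List; []; _∷_; _++_; length; map; allFin; tabulate; deduplicate)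
open import Data.List.Properties using (map-tabulate; map-cong; length-++)
open import Data.List.Membership.Propositional using (_∈_)
open import Data.List.Membership.Propositional.Properties
  using (∈-∃++; ∈-++⁻; ∈-++⁺ˡ; ∈-++⁺ʳ; ∈-map⁺; ∈-allFin)
open import Data.List.Relation.Unary.All as All using (All; []; _∷_)
open import Data.List.Relation.Unary.All.Properties using (deduplicate⁺; map⁺; tabulate⁺)
open import Data.List.Relation.Unary.AllPairs using ([]; _∷_)
open import Data.List.Relation.Unary.Any using (here; there)
import Data.List.Relation.Unary.Any.Properties as Any
open import Data.List.Relation.Unary.Unique.Propositional using (Unique)
open import Data.Nat
open import Data.Nat.DivMod
open import Data.Nat.ListAction using (sum)
open import Data.Nat.Properties
open import Data.Nat.Tactic.RingSolver using (solve-∀)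
open import Data.List.Relation.Unary.Unique.DecPropositional.Properties _≟_ using (deduplicate-!)
open import Data.Product using (∃; _×_; _,_; proj₁; proj₂; uncurry)
open import Data.Sum using (_⊎_; inj₁; inj₂)
open import Function using (_∘_)
open import Function.Bundles using (Equivalence; mk⤖)
open import Function.Consequences.Propositional using (strictlySurjective⇒surjective)
open import Function.Definitions using (Injective; StrictlySurjective)
open import Relation.Binary.PropositionalEquality
open import Relation.Nullary using (contradiction; yes; no)

open Equivalence

sumBelow : ℕ → (ℕ → ℕ) → ℕ
sumBelow zero    f = 0
sumBelow (suc n) f = f 0 + sumBelow n (f ∘ suc)

syntax sumBelow n (λ i → e) = ∑[ i < n ] e

∑-cong : ∀ n {f g : ℕ → ℕ} → (∀ {i} → i < n → f i ≡ g i) → sumBelow n f ≡ sumBelow n g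
∑-cong zero    eq = refl
∑-cong (suc n) eq = cong₂ _+_ (eq z<s) (∑-cong n (eq ∘ s<s))

∑-distrib-+ : ∀ n (f g : ℕ → ℕ) → ∑[ i < n ] (f i + g i) ≡ sumBelow n f + sumBelow n g
∑-distrib-+ zero    f g = refl
∑-distrib-+ (suc n) f g = begin
  (f 0 + g 0) + ∑[ i < n ] (f (suc i) + g (suc i))
    ≡⟨ cong (f 0 + g 0 +_) (∑-distrib-+ n (f ∘ suc) (g ∘ suc)) ⟩
  (f 0 + g 0) + (sumBelow n (f ∘ suc) + sumBelow n (g ∘ suc))
    ≡⟨ interchange (f 0) (g 0) _ _ ⟩
  (f 0 + sumBelow n (f ∘ suc)) + (g 0 + sumBelow n (g ∘ suc)) ∎
  where
  open ≡-Reasoning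
  interchange : ∀ a b c d → (a + b) + (c + d) ≡ (a + c) + (b + d)
  interchange = solve-∀

∑-zero : ∀ n {f : ℕ → ℕ} → (∀ {i} → i < n → f i ≡ 0) → sumBelow n f ≡ 0
∑-zero zero    vanish = refl
∑-zero (suc n) vanish = cong₂ _+_ (vanish z<s) (∑-zero n (vanish ∘ s<s))

∑-point : ∀ n {f : ℕ → ℕ} {p} → p < n → (∀ {i} → i < n → i ≢ p → f i ≡ 0) →
          sumBelow n f ≡ f p
∑-point (suc n) {f} {zero}  _         vanish =
  trans (cong (f 0 +_) (∑-zero n λ i<n → vanish (s<s i<n) λ ())) (+-identityʳ (f 0))
∑-point (suc n) {f} {suc p} (s<s p<n) vanish =
  cong₂ _+_ (vanish z<s λ ()) (∑-point n p<n λ i<n i≢p → vanish (s<s i<n) (i≢p ∘ suc-injective))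

∑-two-points : ∀ n {f : ℕ → ℕ} {p q} → p < n → q < n → p ≢ q →
               (∀ {i} → i < n → i ≢ p → i ≢ q → f i ≡ 0) → sumBelow n f ≡ f p + f q
∑-two-points (suc n) {p = zero}  {zero}  _ _ p≢q _ = contradiction refl p≢q
∑-two-points (suc n) {f} {zero}  {suc q} _ (s<s q<n) _ vanish =
  cong (f 0 +_) (∑-point n q<n λ i<n i≢q → vanish (s<s i<n) (λ ()) (i≢q ∘ suc-injective))
∑-two-points (suc n) {f} {suc p} {zero}  (s<s p<n) _ _ vanish =
  trans (cong (f 0 +_) (∑-point n p<n λ i<n i≢p → vanish (s<s i<n) (i≢p ∘ suc-injective) (λ ())))
        (+-comm (f 0) (f (suc p)))
∑-two-points (suc n) {f} {suc p} {suc q} (s<s p<n) (s<s q<n) p≢q vanish =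
  cong₂ _+_ (vanish z<s (λ ()) (λ ()))
    (∑-two-points n p<n q<n (p≢q ∘ cong suc)
       λ i<n i≢p i≢q → vanish (s<s i<n) (i≢p ∘ suc-injective) (i≢q ∘ suc-injective))

∑-split : ∀ a b (f : ℕ → ℕ) → sumBelow (a + b) f ≡ sumBelow a f + ∑[ j < b ] f (a + j)
∑-split zero    b f = refl
∑-split (suc a) b f = trans (cong (f 0 +_) (∑-split a b (f ∘ suc))) (sym (+-assoc (f 0) _ _))

∑-blocks : ∀ m n (f : ℕ → ℕ) → sumBelow (m * n) f ≡ ∑[ g < m ] ∑[ h < n ] f (g * n + h)
∑-blocks zero    n f = refl
∑-blocks (suc m) n f = begin
  sumBelow (n + m * n) f
    ≡⟨ ∑-split n (m * n) f ⟩
  sumBelow n f + sumBelow (m * n) (λ j → f (n + j))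
    ≡⟨ cong (sumBelow n f +_) (∑-blocks m n (λ j → f (n + j))) ⟩
  sumBelow n f + ∑[ g < m ] ∑[ h < n ] f (n + (g * n + h))
    ≡⟨ cong (sumBelow n f +_) (∑-cong m λ {g} _ → ∑-cong n λ {h} _ →
         cong f (sym (+-assoc n (g * n) h))) ⟩
  sumBelow n f + ∑[ g < m ] ∑[ h < n ] f (suc g * n + h) ∎
  where open ≡-Reasoning

sum-map-allFin : ∀ n (f : ℕ → ℕ) → sum (map (f ∘ toℕ) (allFin n)) ≡ sumBelow n f
sum-map-allFin zero    f = refl
sum-map-allFin (suc n) f = cong (f 0 +_) (begin
  sum (map (f ∘ toℕ) (tabulate {n = n} Fin.suc))
    ≡⟨ cong sum (map-tabulate {n = n} Fin.suc (f ∘ toℕ)) ⟩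
  sum (tabulate {n = n} (f ∘ suc ∘ toℕ))
    ≡⟨ cong sum (map-tabulate {n = n} (λ i → i) (f ∘ suc ∘ toℕ)) ⟨
  sum (map (f ∘ suc ∘ toℕ) (allFin n))
    ≡⟨ sum-map-allFin n (f ∘ suc) ⟩
  sumBelow n (f ∘ suc) ∎)
  where open ≡-Reasoning

double : ℕ → ℕ
double zero    = zero
double (suc n) = suc (suc (double n))

double≡+ : ∀ n → double n ≡ n + n
double≡+ zero    = refl
double≡+ (suc n) = cong suc (trans (cong suc (double≡+ n)) (sym (+-suc n n)))

double-injective : ∀ {a b} → double a ≡ double b → a ≡ b
double-injective {zero}  {zero}  _  = refl
double-injective {suc a} {suc b} eq = cong suc (double-injective (suc-injective (suc-injective eq)))

double≢suc-double : ∀ {a b} → double a ≢ suc (double b)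
double≢suc-double {suc a} {suc b} eq = double≢suc-double (suc-injective (suc-injective eq))

double-mono-≤ : ∀ {a b} → a ≤ b → double a ≤ double b
double-mono-≤ z≤n       = z≤n
double-mono-≤ (s≤s a≤b) = s≤s (s≤s (double-mono-≤ a≤b))

double-<⇒2+≤ : ∀ {j k} → double j < double k → double (suc j) ≤ double k
double-<⇒2+≤ {zero}  {suc k} _                = s≤s (s≤s z≤n)
double-<⇒2+≤ {suc j} {suc k} (s≤s (s≤s 2j<2k)) = s≤s (s≤s (double-<⇒2+≤ 2j<2k))

data DoubleView : ℕ → Set where
  even : ∀ j → DoubleView (double j)
  odd  : ∀ j → DoubleView (suc (double j))

doubleView : ∀ g → DoubleView g
doubleView zero = even 0
doubleView (suc g) with doubleView g
... | even j = odd j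
... | odd  j = even (suc j)

n*2≡double : ∀ n → n * 2 ≡ double n
n*2≡double zero    = refl
n*2≡double (suc n) = cong (suc ∘ suc) (n*2≡double n)

[g*n+h]%n≡h : ∀ g n {h} .{{_ : NonZero n}} → h < n → (g * n + h) % n ≡ h
[g*n+h]%n≡h g n {h} h<n = begin
  (g * n + h) % n  ≡⟨ cong (_% n) (+-comm (g * n) h) ⟩
  (h + g * n) % n  ≡⟨ [m+kn]%n≡m%n h g n ⟩
  h % n            ≡⟨ m<n⇒m%n≡m h<n ⟩
  h                ∎
  where open ≡-Reasoning

[g*n+h]/n≡g : ∀ g n {h} .{{_ : NonZero n}} → h < n → (g * n + h) / n ≡ g
[g*n+h]/n≡g g n {h} h<n = begin
  (g * n + h) / n  ≡⟨ +-distrib-/ (g * n) h (subst (_< n) (sym remainders) h<n) ⟩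
  g * n / n + h / n ≡⟨ cong₂ _+_ (m*n/n≡m g n) (m<n⇒m/n≡0 h<n) ⟩
  g + 0            ≡⟨ +-identityʳ g ⟩
  g                ∎
  where
  open ≡-Reasoning
  remainders : g * n % n + h % n ≡ h
  remainders = cong₂ _+_ (m*n%n≡0 g n) (m<n⇒m%n≡m h<n)

cycleAdjℕ : ℕ → ℕ → ℕ → Bool
cycleAdjℕ m a b =
  (b ≡ᵇ suc a) ∨ (a ≡ᵇ suc b)
  ∨ ((a ≡ᵇ 0) ∧ (suc b ≡ᵇ m))
  ∨ ((b ≡ᵇ 0) ∧ (suc a ≡ᵇ m))

prev : ℕ → ℕ → ℕ
prev m zero    = pred m
prev m (suc a) = a

next : ℕ → ℕ → ℕ
next m a with suc a ≟ m
... | yes _ = 0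
... | no  _ = suc a

next-last : ∀ {m a} → suc a ≡ m → next m a ≡ 0
next-last {m} {a} 1+a≡m with suc a ≟ m
... | yes _    = refl
... | no 1+a≢m = contradiction 1+a≡m 1+a≢m

next-inner : ∀ {m a} → suc a < m → next m a ≡ suc a
next-inner {m} {a} 1+a<m with suc a ≟ m
... | yes 1+a≡m = contradiction 1+a≡m (<⇒≢ 1+a<m)
... | no  _     = refl

next-< : ∀ {m a} → a < m → next m a < m
next-< {m} {a} a<m with suc a ≟ m
... | yes _    = ≤-<-trans z≤n a<m
... | no 1+a≢m = ≤∧≢⇒< a<m 1+a≢m

prev-< : ∀ {m a} → a < m → prev m a < m
prev-< {suc m} {zero}  _   = n<1+n m
prev-< {m}     {suc a} a<m = <-trans (n<1+n a) a<m

next-prev : ∀ {m a} → a < m → next m (prev m a) ≡ a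
next-prev {suc m} {zero}  _   = next-last refl
next-prev {m}     {suc a} a<m = next-inner a<m

prev≢next : ∀ {m a} → 3 ≤ m → a < m → prev m a ≢ next m a
prev≢next {m} {zero} 3≤m _ m-1≡next0 =
  <-irrefl (sym (trans m-1≡next0 (next-inner (≤-trans (s≤s (s≤s z≤n)) 3≤m)))) (pred-mono-≤ 3≤m)
prev≢next {m} {suc a} 3≤m a<m a≡next with suc (suc a) ≟ m
... | yes 2+a≡m =
  contradiction (subst (λ x → 3 ≤ suc (suc x)) a≡next (subst (3 ≤_) (sym 2+a≡m) 3≤m)) λ { (s≤s (s≤s ())) }
... | no _      = <⇒≢ (≤-trans (n<1+n a) (n≤1+n (suc a))) a≡next

adjacent⇒neighbour : ∀ {m a b} → b < m → cycleAdjℕ m a b ≡ true →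
                     b ≡ prev m a ⊎ b ≡ next m a
adjacent⇒neighbour {m} {a} {b} b<m adj with T-∨ .to (T-≡ .from adj)
... | inj₁ b≡1+a = inj₂ (trans b≡1+a′ (sym (next-inner (subst (_< m) b≡1+a′ b<m))))
  where
  b≡1+a′ : b ≡ suc a
  b≡1+a′ = ≡ᵇ⇒≡ b (suc a) b≡1+a
... | inj₂ rest with T-∨ .to rest
...   | inj₁ a≡1+b rewrite ≡ᵇ⇒≡ a (suc b) a≡1+b = inj₁ refl
...   | inj₂ rest′ with T-∨ .to rest′
...     | inj₁ wrapped with T-∧ .to wrapped
...       | a≡0 , 1+b≡m rewrite ≡ᵇ⇒≡ a 0 a≡0 | sym (≡ᵇ⇒≡ (suc b) m 1+b≡m) = inj₁ refl
adjacent⇒neighbour {m} {a} {b} b<m adj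
        | inj₂ rest | inj₂ rest′ | inj₂ wrapped with T-∧ .to wrapped
...       | b≡0 , 1+a≡m = inj₂ (trans (≡ᵇ⇒≡ b 0 b≡0) (sym (next-last (≡ᵇ⇒≡ (suc a) m 1+a≡m))))

≡ᵇ-refl : ∀ n → (n ≡ᵇ n) ≡ true
≡ᵇ-refl n = T-≡ .to (≡⇒≡ᵇ n n refl)

neighbour⇒adjacent : ∀ {m a b} → a < m → b ≡ prev m a ⊎ b ≡ next m a →
                     cycleAdjℕ m a b ≡ true
neighbour⇒adjacent {suc m} {zero}  _ (inj₁ refl) rewrite ≡ᵇ-refl m = ∨-zeroʳ _
neighbour⇒adjacent {m}     {suc a} _ (inj₁ refl) rewrite ≡ᵇ-refl a = ∨-zeroʳ _
neighbour⇒adjacent {m}     {a}     _ (inj₂ refl) with suc a ≟ m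
... | yes 1+a≡m rewrite T-≡ .to (≡⇒≡ᵇ (suc a) m 1+a≡m) =
  trans (cong ((a ≡ᵇ 1) ∨_) (∨-zeroʳ _)) (∨-zeroʳ _)
... | no  _     rewrite ≡ᵇ-refl a = refl

module _ {m} n .{{_ : NonZero n}} (x : Fin (m * n)) where

  toℕ-quotRem : toℕ x ≡ toℕ (proj₂ (quotRem {m} n x)) * n + toℕ (proj₁ (quotRem {m} n x))
  toℕ-quotRem = begin
    toℕ x                                   ≡⟨ cong toℕ (combine-remQuot {m} n x) ⟨
    toℕ (uncurry combine (remQuot {m} n x)) ≡⟨ toℕ-combine (proj₁ (remQuot {m} n x)) _ ⟩
    n * toℕ layer + toℕ slot                ≡⟨ cong (_+ toℕ slot) (*-comm n (toℕ layer)) ⟩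
    toℕ layer * n + toℕ slot                ∎
    where
    open ≡-Reasoning
    layer : Fin m
    layer = proj₂ (quotRem {m} n x)
    slot : Fin n
    slot = proj₁ (quotRem {m} n x)

  toℕ-quotRem-layer : toℕ (proj₂ (quotRem {m} n x)) ≡ toℕ x / n
  toℕ-quotRem-layer =
    sym (trans (cong (_/ n) toℕ-quotRem) ([g*n+h]/n≡g _ n (toℕ<n (proj₁ (quotRem {m} n x)))))

cycleLexEmpty-layers : ∀ m n .{{_ : NonZero n}} (u v : Fin (m * n)) →
                       cycleLexEmpty m n u v ≡ cycleAdjℕ m (toℕ u / n) (toℕ v / n)
cycleLexEmpty-layers m n u v = begin
  cycleAdj m gu gv ∨ ((gu =ᶠ gv) ∧ false)
    ≡⟨ cong (cycleAdj m gu gv ∨_) (∧-zeroʳ (gu =ᶠ gv)) ⟩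
  cycleAdj m gu gv ∨ false
    ≡⟨ ∨-identityʳ (cycleAdj m gu gv) ⟩
  cycleAdjℕ m (toℕ gu) (toℕ gv)
    ≡⟨ cong₂ (cycleAdjℕ m) (toℕ-quotRem-layer {m} n u) (toℕ-quotRem-layer {m} n v) ⟩
  cycleAdjℕ m (toℕ u / n) (toℕ v / n) ∎
  where
  open ≡-Reasoning
  gu gv : Fin m
  gu = proj₂ (quotRem {m} n u)
  gv = proj₂ (quotRem {m} n v)

module _ {m n : ℕ} .{{_ : NonZero m}} .{{_ : NonZero n}} where

  -- The vertex in slot 0 of layer g; reducing g mod m only serves to make it total.
  layerRep : ℕ → Fin (m * n)
  layerRep g = fromℕ< (*-monoˡ-< n (m%n<n g m))

  layerRep-layer : ∀ {g} → g < m → toℕ (layerRep g) / n ≡ g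
  layerRep-layer {g} g<m = begin
    toℕ (layerRep g) / n ≡⟨ cong (_/ n) (toℕ-fromℕ< (*-monoˡ-< n (m%n<n g m))) ⟩
    g % m * n / n        ≡⟨ m*n/n≡m (g % m) n ⟩
    g % m                ≡⟨ m<n⇒m%n≡m g<m ⟩
    g                    ∎
    where open ≡-Reasoning

  layerRep-adjacent : ∀ {g} → g < m → cycleLexEmpty m n (layerRep g) (layerRep (next m g)) ≡ true
  layerRep-adjacent {g} g<m = begin
    cycleLexEmpty m n (layerRep g) (layerRep (next m g))
      ≡⟨ cycleLexEmpty-layers m n _ _ ⟩
    cycleAdjℕ m (toℕ (layerRep g) / n) (toℕ (layerRep (next m g)) / n)
      ≡⟨ cong₂ (cycleAdjℕ m) (layerRep-layer g<m) (layerRep-layer (next-< g<m)) ⟩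
    cycleAdjℕ m g (next m g)
      ≡⟨ neighbour⇒adjacent g<m (inj₂ refl) ⟩
    true ∎
    where open ≡-Reasoning

∈-remove : ∀ {x y : ℕ} (l r : List ℕ) → x ≢ y → x ∈ l ++ y ∷ r → x ∈ l ++ r
∈-remove l r x≢y x∈ with ∈-++⁻ l x∈
... | inj₁ x∈l         = ∈-++⁺ˡ x∈l
... | inj₂ (here x≡y)  = contradiction x≡y x≢y
... | inj₂ (there x∈r) = ∈-++⁺ʳ l x∈r

unique-⊆⇒length-≤ : ∀ {ys zs : List ℕ} → Unique ys → All (_∈ zs) ys → length ys ≤ length zs
unique-⊆⇒length-≤ {[]}     _               _           = z≤n
unique-⊆⇒length-≤ {y ∷ ys} (y∉ys ∷ unique) (y∈zs ∷ ys⊆zs) with ∈-∃++ y∈zs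
... | l , r , refl = begin
  suc (length ys)           ≤⟨ s≤s (unique-⊆⇒length-≤ unique ys⊆l++r) ⟩
  suc (length (l ++ r))     ≡⟨ cong suc (length-++ l) ⟩
  suc (length l + length r) ≡⟨ +-suc (length l) (length r) ⟨
  length l + length (y ∷ r) ≡⟨ length-++ l ⟨
  length (l ++ y ∷ r)       ∎
  where
  open ≤-Reasoning
  ys⊆l++r : All (_∈ l ++ r) ys
  ys⊆l++r = All.zipWith (λ (y≢y′ , y′∈) → ∈-remove l r (y≢y′ ∘ sym) y′∈) (y∉ys , ys⊆zs)

OneOf₃ : ℕ → ℕ → ℕ → ℕ → Set
OneOf₃ a b c x = x ≡ a ⊎ x ≡ b ⊎ x ≡ c

length-deduplicate-≤3 : ∀ {a b c} xs → All (OneOf₃ a b c) xs → length (deduplicate _≟_ xs) ≤ 3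
length-deduplicate-≤3 {a} {b} {c} xs all-three =
  unique-⊆⇒length-≤ (deduplicate-! xs) (All.map one-of (deduplicate⁺ _≟_ all-three))
  where
  one-of : ∀ {x} → OneOf₃ a b c x → x ∈ a ∷ b ∷ c ∷ []
  one-of (inj₁ x≡a)        = here x≡a
  one-of (inj₂ (inj₁ x≡b)) = there (here x≡b)
  one-of (inj₂ (inj₂ x≡c)) = there (there (here x≡c))

length-deduplicate-≥3 : ∀ {a b c} xs → a ≢ b → a ≢ c → b ≢ c → a ∈ xs → b ∈ xs → c ∈ xs →
                        3 ≤ length (deduplicate _≟_ xs)
length-deduplicate-≥3 xs a≢b a≢c b≢c a∈ b∈ c∈ =
  unique-⊆⇒length-≤ ((a≢b ∷ a≢c ∷ []) ∷ (b≢c ∷ []) ∷ [] ∷ []) (kept a∈ ∷ kept b∈ ∷ kept c∈ ∷ [])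
  where
  kept : ∀ {x} → x ∈ xs → x ∈ deduplicate _≟_ xs
  kept = Any.deduplicate⁺ _≟_ (λ y≡x x≡z → trans x≡z (sym y≡x))

-- Lower bound

oddCycle-thirdColour : ∀ k (c : ℕ → ℕ) → (∀ {g} → g < double k → c g ≢ c (suc g)) →
                       c (double k) ≢ c 0 → ∃ λ g → g ≤ double k × c g ≢ c 0 × c g ≢ c 1
oddCycle-thirdColour k c proper wrap with alternating k ≤-refl
  where
  ThirdColour : Set
  ThirdColour = ∃ λ g → g ≤ double k × c g ≢ c 0 × c g ≢ c 1
  alternating : ∀ i → double i ≤ double k → c (double i) ≡ c 0 ⊎ ThirdColour
  alternating zero    _       = inj₁ refl
  alternating (suc i) 2i+2≤2k with alternating i (≤-trans (m≤n+m (double i) 2) 2i+2≤2k)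
  ... | inj₂ third = inj₂ third
  ... | inj₁ c2i≡c0 with c (suc (double i)) ≟ c 1
  ...   | no c2i+1≢c1 = inj₂ (suc (double i) , 2i+1≤2k , c2i+1≢c0 , c2i+1≢c1)
    where
    2i+1≤2k : suc (double i) ≤ double k
    2i+1≤2k = ≤-trans (n≤1+n _) 2i+2≤2k
    c2i+1≢c0 : c (suc (double i)) ≢ c 0
    c2i+1≢c0 eq = proper 2i+1≤2k (trans c2i≡c0 (sym eq))
  ...   | yes c2i+1≡c1 with c (double (suc i)) ≟ c 0
  ...     | yes c2i+2≡c0 = inj₁ c2i+2≡c0
  ...     | no  c2i+2≢c0 = inj₂ (double (suc i) , 2i+2≤2k , c2i+2≢c0 ,
                                 λ eq → proper 2i+2≤2k (trans c2i+1≡c1 (sym eq)))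
... | inj₁ c2k≡c0 = contradiction c2k≡c0 wrap
... | inj₂ third  = third

chiLd-lower : ∀ {k n} .{{_ : NonZero n}} → 1 ≤ k → (f : Labeling (suc (double k) * n)) →
              IsLDA (cycleLexEmpty (suc (double k)) n) f → 3 ≤ numWeights (cycleLexEmpty (suc (double k)) n) f
chiLd-lower {k} {n} 1≤k f isLDA = third-weight (oddCycle-thirdColour k c proper wrap)
  where
  m : ℕ
  m = suc (double k)
  A : Fin (m * n) → Fin (m * n) → Bool
  A = cycleLexEmpty m n
  c : ℕ → ℕ
  c g = weight A f (layerRep {m} g)
  c-next : ∀ {g} → g < m → c g ≢ c (next m g)
  c-next g<m = isLDA _ _ (layerRep-adjacent g<m)
  proper : ∀ {g} → g < double k → c g ≢ c (suc g)
  proper {g} g<2k = subst (λ h → c g ≢ c h) (next-inner {m} (s≤s g<2k)) (c-next (<-trans g<2k (n<1+n _)))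
  wrap : c (double k) ≢ c 0
  wrap = subst (λ h → c (double k) ≢ c h) (next-last {m} {double k} refl) (c-next (n<1+n _))
  c0≢c1 : c 0 ≢ c 1
  c0≢c1 = proper (≤-trans (n≤1+n 1) (double-mono-≤ 1≤k))
  listed : ∀ g → c g ∈ map (weight A f) (allFin (m * n))
  listed g = ∈-map⁺ (weight A f) (∈-allFin (layerRep g))
  third-weight : (∃ λ g → g ≤ double k × c g ≢ c 0 × c g ≢ c 1) → 3 ≤ numWeights A f
  third-weight (g , _ , cg≢c0 , cg≢c1) =
    length-deduplicate-≥3 _ c0≢c1 (cg≢c0 ∘ sym) (cg≢c1 ∘ sym) (listed 0) (listed 1) (listed g)

-- Labelings built from rows of permutations

injective⇒strictlySurjective : ∀ {N} (f : Fin N → Fin N) → Injective _≡_ _≡_ f →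
                               StrictlySurjective _≡_ f
injective⇒strictlySurjective f f-inj y with any? (λ x → f x Fin.≟ y)
... | yes hit = hit
injective⇒strictlySurjective {suc N} f f-inj y | no miss =
  contradiction (λ {a b} → f-avoiding-y-injective {a} {b}) (<⇒notInjective (n<1+n N))
  where
  f-avoiding-y : Fin (suc N) → Fin N
  f-avoiding-y x = punchOut {i = y} (miss ∘ (x ,_) ∘ sym)
  f-avoiding-y-injective : Injective _≡_ _≡_ f-avoiding-y
  f-avoiding-y-injective {a} {b} = f-inj ∘ punchOut-injective (miss ∘ (a ,_) ∘ sym) (miss ∘ (b ,_) ∘ sym)

record Permutes (m : ℕ) (σ : ℕ → ℕ) : Set where
  field
    <-closed  : ∀ {g} → g < m → σ g < m
    injective : ∀ {g g′} → g < m → g′ < m → σ g ≡ σ g′ → g ≡ g′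

module RowLabeling {m n : ℕ} .{{_ : NonZero n}} (3≤m : 3 ≤ m)
  (row : ℕ → ℕ → ℕ) (row-permutes : ∀ {h} → h < n → Permutes m (row h)) where

  open Permutes

  instance
    m-nonZero : NonZero m
    m-nonZero = >-nonZero (≤-trans (s≤s z≤n) 3≤m)

  labelℕ : ℕ → ℕ
  labelℕ x = (x % n) * m + row (x % n) (x / n)

  private
    row-<′ : ∀ {x} → x < m * n → row (x % n) (x / n) < m
    row-<′ {x} x<mn = row-permutes (m%n<n x n) .<-closed (m<n*o⇒m/o<n x<mn)

  labelℕ-< : ∀ {x} → x < m * n → labelℕ x < m * n
  labelℕ-< {x} x<mn = begin-strict
    (x % n) * m + row (x % n) (x / n) <⟨ +-monoʳ-< ((x % n) * m) (row-<′ x<mn) ⟩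
    (x % n) * m + m                   ≡⟨ +-comm _ m ⟩
    suc (x % n) * m                   ≤⟨ *-monoˡ-≤ m (m%n<n x n) ⟩
    n * m                             ≡⟨ *-comm n m ⟩
    m * n                             ∎
    where open ≤-Reasoning

  labelℕ-injective : ∀ {x y} → x < m * n → y < m * n → labelℕ x ≡ labelℕ y → x ≡ y
  labelℕ-injective {x} {y} x<mn y<mn eq = begin
    x                   ≡⟨ m≡m%n+[m/n]*n x n ⟩
    x % n + (x / n) * n ≡⟨ cong₂ (λ h g → h + g * n) same-slot same-layer ⟩
    y % n + (y / n) * n ≡⟨ m≡m%n+[m/n]*n y n ⟨
    y                   ∎
    where
    open ≡-Reasoning
    same-slot : x % n ≡ y % n
    same-slot = begin
      x % n          ≡⟨ [g*n+h]/n≡g (x % n) m (row-<′ x<mn) ⟨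
      labelℕ x / m   ≡⟨ cong (_/ m) eq ⟩
      labelℕ y / m   ≡⟨ [g*n+h]/n≡g (y % n) m (row-<′ y<mn) ⟩
      y % n          ∎
    same-row-entry : row (x % n) (x / n) ≡ row (x % n) (y / n)
    same-row-entry = begin
      row (x % n) (x / n) ≡⟨ [g*n+h]%n≡h (x % n) m (row-<′ x<mn) ⟨
      labelℕ x % m        ≡⟨ cong (_% m) eq ⟩
      labelℕ y % m        ≡⟨ [g*n+h]%n≡h (y % n) m (row-<′ y<mn) ⟩
      row (y % n) (y / n) ≡⟨ cong (λ h → row h (y / n)) same-slot ⟨
      row (x % n) (y / n) ∎
    same-layer : x / n ≡ y / n
    same-layer = row-permutes (m%n<n x n) .injective
      (m<n*o⇒m/o<n x<mn) (m<n*o⇒m/o<n y<mn) same-row-entry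

  labelFin : Fin (m * n) → Fin (m * n)
  labelFin v = fromℕ< (labelℕ-< (toℕ<n v))

  toℕ-labelFin : ∀ v → toℕ (labelFin v) ≡ labelℕ (toℕ v)
  toℕ-labelFin v = toℕ-fromℕ< (labelℕ-< (toℕ<n v))

  labelFin-injective : Injective _≡_ _≡_ labelFin
  labelFin-injective {u} {v} eq = toℕ-injective (labelℕ-injective (toℕ<n u) (toℕ<n v)
    (trans (sym (toℕ-labelFin u)) (trans (cong toℕ eq) (toℕ-labelFin v))))

  labeling : Labeling (m * n)
  labeling = mk⤖ (labelFin-injective , strictlySurjective⇒surjective
    (injective⇒strictlySurjective labelFin labelFin-injective))

  layerSum : ℕ → ℕ
  layerSum g = ∑[ h < n ] suc (h * m + row h g)

  weight-layerSum : ∀ u → let g = toℕ u / n in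
    weight (cycleLexEmpty m n) labeling u ≡ layerSum (prev m g) + layerSum (next m g)
  weight-layerSum u = begin
    weight (cycleLexEmpty m n) labeling u        ≡⟨ cong sum (map-cong as-function-of-index (allFin (m * n))) ⟩
    sum (map (summand ∘ toℕ) (allFin (m * n)))  ≡⟨ sum-map-allFin (m * n) summand ⟩
    sumBelow (m * n) summand                     ≡⟨ ∑-blocks m n summand ⟩
    ∑[ g < m ] ∑[ h < n ] summand (g * n + h)    ≡⟨ ∑-cong m block ⟩
    ∑[ g < m ] neighbourSum g
      ≡⟨ ∑-two-points m (prev-< a<m) (next-< a<m) (prev≢next 3≤m a<m) non-neighbour ⟩
    neighbourSum (prev m a) + neighbourSum (next m a)
      ≡⟨ cong₂ _+_ (neighbour (inj₁ refl)) (neighbour (inj₂ refl)) ⟩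
    layerSum (prev m a) + layerSum (next m a)    ∎
    where
    open ≡-Reasoning
    a : ℕ
    a = toℕ u / n
    a<m : a < m
    a<m = m<n*o⇒m/o<n (toℕ<n u)
    summand : ℕ → ℕ
    summand y = if cycleAdjℕ m a (y / n) then suc (labelℕ y) else 0
    as-function-of-index : ∀ v → (if cycleLexEmpty m n u v then label labeling v else 0) ≡ summand (toℕ v)
    as-function-of-index v rewrite cycleLexEmpty-layers m n u v | toℕ-labelFin v = refl
    neighbourSum : ℕ → ℕ
    neighbourSum g = if cycleAdjℕ m a g then layerSum g else 0
    block : ∀ {g} → g < m → ∑[ h < n ] summand (g * n + h) ≡ neighbourSum g
    block {g} _ = trans (∑-cong n entry) (pull-out (cycleAdjℕ m a g))
      where
      entry : ∀ {h} → h < n →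
              summand (g * n + h) ≡ (if cycleAdjℕ m a g then suc (h * m + row h g) else 0)
      entry h<n = cong₂ (λ l s → if cycleAdjℕ m a l then suc (s * m + row s l) else 0)
        ([g*n+h]/n≡g g n h<n) ([g*n+h]%n≡h g n h<n)
      pull-out : ∀ b → ∑[ h < n ] (if b then suc (h * m + row h g) else 0) ≡ (if b then layerSum g else 0)
      pull-out true  = refl
      pull-out false = ∑-zero n λ _ → refl
    non-neighbour : ∀ {g} → g < m → g ≢ prev m a → g ≢ next m a → neighbourSum g ≡ 0
    non-neighbour {g} g<m g≢prev g≢next with cycleAdjℕ m a g in adj
    ... | false = refl
    ... | true  with adjacent⇒neighbour g<m adj
    ...   | inj₁ g≡prev = contradiction g≡prev g≢prev
    ...   | inj₂ g≡next = contradiction g≡next g≢next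
    neighbour : ∀ {g} → g ≡ prev m a ⊎ g ≡ next m a → neighbourSum g ≡ layerSum g
    neighbour {g} g∈ rewrite neighbour⇒adjacent a<m g∈ = refl

-- Kotzig arrays

-- A Kotzig array with r + 1 rows and m columns whose first row is the identity; only the
-- other r rows are stored, and colSum-eq adds the identity entry g by hand.
record KotzigArray (r m : ℕ) : Set where
  field
    row          : ℕ → ℕ → ℕ
    row-permutes : ∀ {h} → h < r → Permutes m (row h)
    colSum       : ℕ
    colSum-eq    : ∀ {g} → g < m → g + ∑[ h < r ] row h g ≡ colSum

consRow : (ℕ → ℕ) → (ℕ → ℕ → ℕ) → ℕ → ℕ → ℕ
consRow σ rows zero    = σ
consRow σ rows (suc h) = rows h

consRow-permutes : ∀ {m r σ rows} → Permutes m σ → (∀ {h} → h < r → Permutes m (rows h)) →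
                   ∀ {h} → h < suc r → Permutes m (consRow σ rows h)
consRow-permutes σ-permutes rows-permute {zero}  _         = σ-permutes
consRow-permutes σ-permutes rows-permute {suc h} (s<s h<r) = rows-permute h<r

id-permutes : ∀ {m} → Permutes m (λ g → g)
id-permutes = record { <-closed = λ g<m → g<m ; injective = λ _ _ eq → eq }

reverse-permutes : ∀ {m} → Permutes (suc m) (m ∸_)
reverse-permutes {m} = record
  { <-closed  = λ {g} _ → s≤s (m∸n≤m m g)
  ; injective = λ g<1+m g′<1+m → ∸-cancelˡ-≡ (s≤s⁻¹ g<1+m) (s≤s⁻¹ g′<1+m)
  }

reversal : ∀ m → KotzigArray 1 (suc m)
reversal m = record
  { row          = λ _ → m ∸_
  ; row-permutes = λ _ → reverse-permutes
  ; colSum       = m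
  ; colSum-eq    = λ {g} g<1+m → trans (cong (g +_) (+-identityʳ (m ∸ g))) (m+[n∸m]≡n (s≤s⁻¹ g<1+m))
  }

addReversalPair : ∀ {r m} → KotzigArray r (suc m) → KotzigArray (2 + r) (suc m)
addReversalPair {r} {m} K = record
  { row          = consRow (λ g → g) (consRow (m ∸_) row)
  ; row-permutes = consRow-permutes id-permutes (consRow-permutes reverse-permutes row-permutes)
  ; colSum       = m + colSum
  ; colSum-eq    = λ {g} g<1+m → begin
      g + (g + ((m ∸ g) + ∑[ h < r ] row h g))
        ≡⟨ regroup g (m ∸ g) _ ⟩
      (g + (m ∸ g)) + (g + ∑[ h < r ] row h g)
        ≡⟨ cong₂ _+_ (m+[n∸m]≡n (s≤s⁻¹ g<1+m)) (colSum-eq g<1+m) ⟩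
      m + colSum ∎
  }
  where
  open KotzigArray K
  open ≡-Reasoning
  regroup : ∀ a b c → a + (a + (b + c)) ≡ (a + b) + (a + c)
  regroup = solve-∀

rotate : ℕ → ℕ → ℕ
rotate k g with g ≤? k
... | yes _ = k + g
... | no  _ = g ∸ suc k

data Half (k : ℕ) : ℕ → Set where
  lower : ∀ {i} → i ≤ k → Half k i
  upper : ∀ {i} → i < k → Half k (suc (k + i))

half : ∀ {k g} → g < suc (double k) → Half k g
half {k} {g} g<m with g ≤? k
... | yes g≤k = lower g≤k
... | no  g≰k = subst (Half k) (m+[n∸m]≡n k<g) (upper (+-cancelˡ-< k _ _ bound))
  where
  k<g : suc k ≤ g
  k<g = ≰⇒> g≰k
  bound : k + (g ∸ suc k) < k + k
  bound = begin-strict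
    k + (g ∸ suc k)     <⟨ n<1+n _ ⟩
    suc k + (g ∸ suc k) ≡⟨ m+[n∸m]≡n k<g ⟩
    g                   ≤⟨ s≤s⁻¹ g<m ⟩
    double k            ≡⟨ double≡+ k ⟩
    k + k               ∎
    where open ≤-Reasoning

rotate-lower : ∀ {k i} → i ≤ k → rotate k i ≡ k + i
rotate-lower {k} {i} i≤k with i ≤? k
... | yes _   = refl
... | no  i≰k = contradiction i≤k i≰k

rotate-upper : ∀ k i → rotate k (suc (k + i)) ≡ i
rotate-upper k i with suc (k + i) ≤? k
... | yes k+i<k = contradiction k+i<k (m+n≮m k i)
... | no  _     = m+n∸m≡n k i

rotate-permutes : ∀ k → Permutes (suc (double k)) (rotate k)
rotate-permutes k = record { <-closed = <-closed ∘ half ; injective = λ g< g′< → injective (half g<) (half g′<) }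
  where
  k+i<m : ∀ {i} → i ≤ k → k + i < suc (double k)
  k+i<m {i} i≤k = s≤s (subst (k + i ≤_) (sym (double≡+ k)) (+-monoʳ-≤ k i≤k))
  k<m : k < suc (double k)
  k<m = s≤s (subst (k ≤_) (sym (double≡+ k)) (m≤m+n k k))
  <-closed : ∀ {g} → Half k g → rotate k g < suc (double k)
  <-closed (lower i≤k)      = subst (_< _) (sym (rotate-lower i≤k)) (k+i<m i≤k)
  <-closed (upper {i} i<k)  = subst (_< _) (sym (rotate-upper k i)) (<-trans i<k k<m)
  injective : ∀ {g g′} → Half k g → Half k g′ → rotate k g ≡ rotate k g′ → g ≡ g′
  injective (lower i≤k) (lower i′≤k) eq =
    +-cancelˡ-≡ k _ _ (trans (sym (rotate-lower i≤k)) (trans eq (rotate-lower i′≤k)))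
  injective (upper {i} _) (upper {i′} _) eq =
    cong (suc ∘ (k +_)) (trans (sym (rotate-upper k i)) (trans eq (rotate-upper k i′)))
  injective (lower {i} i≤k) (upper {i′} i′<k) eq =
    contradiction (trans (sym (rotate-lower i≤k)) (trans eq (rotate-upper k i′)))
                  (>⇒≢ (≤-trans i′<k (m≤m+n k i)))
  injective (upper {i} i<k) (lower {i′} i′≤k) eq =
    contradiction (trans (sym (rotate-upper k i)) (trans eq (rotate-lower i′≤k)))
                  (<⇒≢ (≤-trans i<k (m≤m+n k i′)))

spread : ℕ → ℕ → ℕ
spread k g = g + rotate k g

spread-lower : ∀ {k i} → i ≤ k → spread k i ≡ k + double i
spread-lower {k} {i} i≤k = begin
  i + rotate k i ≡⟨ cong (i +_) (rotate-lower i≤k) ⟩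
  i + (k + i)    ≡⟨ swap i k ⟩
  k + (i + i)    ≡⟨ cong (k +_) (double≡+ i) ⟨
  k + double i   ∎
  where
  open ≡-Reasoning
  swap : ∀ i k → i + (k + i) ≡ k + (i + i)
  swap = solve-∀

spread-upper : ∀ k i → spread k (suc (k + i)) ≡ k + suc (double i)
spread-upper k i = begin
  suc (k + i) + rotate k (suc (k + i)) ≡⟨ cong (suc (k + i) +_) (rotate-upper k i) ⟩
  suc (k + i) + i                      ≡⟨ swap k i ⟩
  k + suc (i + i)                      ≡⟨ cong (λ d → k + suc d) (double≡+ i) ⟨
  k + suc (double i)                   ∎
  where
  open ≡-Reasoning
  swap : ∀ k i → suc (k + i) + i ≡ k + suc (i + i)
  swap = solve-∀

spread-bounded : ∀ {k g} → Half k g → k ≤ spread k g × spread k g ≤ k + double k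
spread-bounded {k} (lower {i} i≤k) rewrite spread-lower i≤k =
  m≤m+n k (double i) , +-monoʳ-≤ k (double-mono-≤ i≤k)
spread-bounded {k} (upper {i} i<k) rewrite spread-upper k i =
  m≤m+n k _ , +-monoʳ-≤ k (≤-trans (n≤1+n _) (double-mono-≤ i<k))

spread-injective : ∀ {k g g′} → Half k g → Half k g′ → spread k g ≡ spread k g′ → g ≡ g′
spread-injective {k} (lower i≤k) (lower i′≤k) eq
  rewrite spread-lower i≤k | spread-lower i′≤k = double-injective (+-cancelˡ-≡ k _ _ eq)
spread-injective {k} (upper {i} _) (upper {i′} _) eq
  rewrite spread-upper k i | spread-upper k i′ =
  cong (suc ∘ (k +_)) (double-injective (suc-injective (+-cancelˡ-≡ k _ _ eq)))
spread-injective {k} (lower i≤k) (upper {i′} _) eq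
  rewrite spread-lower i≤k | spread-upper k i′ = contradiction (+-cancelˡ-≡ k _ _ eq) double≢suc-double
spread-injective {k} (upper {i} _) (lower i′≤k) eq
  rewrite spread-upper k i | spread-lower i′≤k = contradiction (+-cancelˡ-≡ k _ _ (sym eq)) double≢suc-double

complement : ℕ → ℕ → ℕ
complement k g = (k + double k) ∸ spread k g

complement-permutes : ∀ k → Permutes (suc (double k)) (complement k)
complement-permutes k = record
  { <-closed  = λ {g} g<m → s≤s (begin
      (k + double k) ∸ spread k g       ≤⟨ ∸-monoʳ-≤ (k + double k) (proj₁ (spread-bounded (half g<m))) ⟩
      (k + double k) ∸ k                ≡⟨ m+n∸m≡n k (double k) ⟩
      double k                          ∎)
  ; injective = λ g<m g′<m eq → spread-injective (half g<m) (half g′<m)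
      (∸-cancelˡ-≡ (proj₂ (spread-bounded (half g<m))) (proj₂ (spread-bounded (half g′<m))) eq)
  }
  where open ≤-Reasoning

triple : ∀ k → KotzigArray 2 (suc (double k))
triple k = record
  { row          = consRow (rotate k) (λ _ → complement k)
  ; row-permutes = consRow-permutes (rotate-permutes k) (λ _ → complement-permutes k)
  ; colSum       = k + double k
  ; colSum-eq    = λ {g} g<m → trans (regroup g (rotate k g) (complement k g))
                                     (m+[n∸m]≡n (proj₂ (spread-bounded (half g<m))))
  }
  where
  regroup : ∀ a b c → a + (b + (c + 0)) ≡ a + b + c
  regroup = solve-∀

kotzigArray : ∀ k r → KotzigArray (suc r) (suc (double k))
kotzigArray k zero          = reversal (double k)
kotzigArray k (suc zero)    = triple k
kotzigArray k (suc (suc r)) = addReversalPair (kotzigArray k r)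

-- Perturbing the identity row

swapMod4 : ℕ → ℕ
swapMod4 0 = 0
swapMod4 1 = 2
swapMod4 2 = 1
swapMod4 3 = 3
swapMod4 (suc (suc (suc (suc g)))) = 4 + swapMod4 g

excess : ℕ → ℕ
excess 0 = 1
excess 1 = 2
excess 2 = 0
excess 3 = 1
excess (suc (suc (suc (suc g)))) = excess g

swapMod4-excess : ∀ g → swapMod4 g + 1 ≡ g + excess g
swapMod4-excess 0 = refl
swapMod4-excess 1 = refl
swapMod4-excess 2 = refl
swapMod4-excess 3 = refl
swapMod4-excess (suc (suc (suc (suc g)))) = cong (4 +_) (swapMod4-excess g)

swapMod4-involutive : ∀ g → swapMod4 (swapMod4 g) ≡ g
swapMod4-involutive 0 = refl
swapMod4-involutive 1 = refl
swapMod4-involutive 2 = refl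
swapMod4-involutive 3 = refl
swapMod4-involutive (suc (suc (suc (suc g)))) = cong (4 +_) (swapMod4-involutive g)

-- Oddness of the bound matters: a bound 4i + 2 would separate 4i + 1 from its partner.
swapMod4-< : ∀ k {g} → g < suc (double k) → swapMod4 g < suc (double k)
swapMod4-< k       {0} g<m = g<m
swapMod4-< zero    {1} (s≤s ())
swapMod4-< (suc k) {1} _   = s≤s (s≤s (s≤s z≤n))
swapMod4-< k       {2} g<m = <-trans (n<1+n 1) g<m
swapMod4-< k       {3} g<m = g<m
swapMod4-< zero {suc (suc (suc (suc g)))} (s≤s ())
swapMod4-< (suc zero) {suc (suc (suc (suc g)))} (s≤s (s≤s (s≤s ())))
swapMod4-< (suc (suc k)) {suc (suc (suc (suc g)))} (s≤s (s≤s (s≤s (s≤s g<m)))) =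
  s≤s (s≤s (s≤s (s≤s (swapMod4-< k g<m))))

swapMod4-permutes : ∀ k → Permutes (suc (double k)) swapMod4
swapMod4-permutes k = record
  { <-closed  = swapMod4-< k
  ; injective = λ {g} {g′} _ _ eq →
      trans (sym (swapMod4-involutive g)) (trans (cong swapMod4 eq) (swapMod4-involutive g′))
  }

excess-even-gap : ∀ j → excess (double j) + excess (2 + double j) ≡ 1
excess-even-gap 0 = refl
excess-even-gap 1 = refl
excess-even-gap (suc (suc j)) = excess-even-gap j

excess-odd-gap : ∀ j → excess (suc (double j)) + excess (3 + double j) ≡ 3
excess-odd-gap 0 = refl
excess-odd-gap 1 = refl
excess-odd-gap (suc (suc j)) = excess-odd-gap j

excess-boundary : ∀ j → (excess (double (suc j)) ≡ 0 × excess (suc (double j)) ≡ 2)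
                      ⊎ (excess (double (suc j)) ≡ 1 × excess (suc (double j)) ≡ 1)
excess-boundary 0 = inj₁ (refl , refl)
excess-boundary 1 = inj₂ (refl , refl)
excess-boundary (suc (suc j)) = excess-boundary j

neighbourExcess : ℕ → ℕ → ℕ
neighbourExcess m g = excess (prev m g) + excess (next m g)

neighbourExcess-odd : ∀ {k j} → suc (double j) < suc (double k) →
                      neighbourExcess (suc (double k)) (suc (double j)) ≡ 1
neighbourExcess-odd {k} {j} (s≤s 2j<2k)
  rewrite next-inner {suc (double k)} (s≤s (double-<⇒2+≤ 2j<2k)) = excess-even-gap j

neighbourExcess-inner : ∀ {k j} → double (suc j) < double k →
                        neighbourExcess (suc (double k)) (double (suc j)) ≡ 3
neighbourExcess-inner {k} {j} 2j+2<2k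
  rewrite next-inner {suc (double k)} (s≤s 2j+2<2k) = excess-odd-gap j

neighbourExcess-ends : ∀ {k} → 1 ≤ k → let D = neighbourExcess (suc (double k)) in
  (D 0 ≡ 2 × D (double k) ≡ 3) ⊎ (D 0 ≡ 3 × D (double k) ≡ 2)
neighbourExcess-ends {suc k}  _
  rewrite next-inner {suc (double (suc k))} {0} (s≤s (s≤s z≤n))
        | next-last {suc (double (suc k))} {double (suc k)} refl
  with excess-boundary k
... | inj₁ (e₀ , e₁) = inj₁ (cong (_+ 2) e₀ , cong (_+ 1) e₁)
... | inj₂ (e₀ , e₁) = inj₂ (cong (_+ 2) e₀ , cong (_+ 1) e₁)

TwoOrThree : ℕ → Set
TwoOrThree x = x ≡ 2 ⊎ x ≡ 3

TwoOrThree⇒≢1 : ∀ {x} → TwoOrThree x → x ≢ 1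
TwoOrThree⇒≢1 (inj₁ refl) ()
TwoOrThree⇒≢1 (inj₂ refl) ()

neighbourExcess-even : ∀ {k j} → 1 ≤ k → double j < suc (double k) →
                       TwoOrThree (neighbourExcess (suc (double k)) (double j))
neighbourExcess-even {k} {zero} 1≤k _ with neighbourExcess-ends 1≤k
... | inj₁ (D₀ , _) = inj₁ D₀
... | inj₂ (D₀ , _) = inj₂ D₀
neighbourExcess-even {k} {suc j} 1≤k (s≤s 2j≤2k) with m≤n⇒m<n∨m≡n 2j≤2k
... | inj₁ 2j<2k = inj₂ (neighbourExcess-inner 2j<2k)
... | inj₂ 2j≡2k = subst (TwoOrThree ∘ neighbourExcess (suc (double k))) (sym 2j≡2k) last
  where
  last : TwoOrThree (neighbourExcess (suc (double k)) (double k))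
  last with neighbourExcess-ends 1≤k
  ... | inj₁ (_ , Dₗ) = inj₂ Dₗ
  ... | inj₂ (_ , Dₗ) = inj₁ Dₗ

neighbourExcess-values : ∀ {k g} → 1 ≤ k → g < suc (double k) →
                         neighbourExcess (suc (double k)) g ≡ 1 ⊎ TwoOrThree (neighbourExcess (suc (double k)) g)
neighbourExcess-values {k} {g} 1≤k g<m with doubleView g
... | odd  j = inj₁ (neighbourExcess-odd g<m)
... | even j = inj₂ (neighbourExcess-even 1≤k g<m)

neighbourExcess-proper : ∀ {k g} → 1 ≤ k → g < suc (double k) → let m = suc (double k) in
                         neighbourExcess m g ≢ neighbourExcess m (next m g)
neighbourExcess-proper {k} {g} 1≤k g<m with doubleView g
... | odd j = λ eq → TwoOrThree⇒≢1 D-next (trans (sym eq) (neighbourExcess-odd g<m))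
  where
  2j+2<m = s≤s (double-<⇒2+≤ (s≤s⁻¹ g<m))
  D-next = subst (TwoOrThree ∘ neighbourExcess (suc (double k))) (sym (next-inner 2j+2<m))
                 (neighbourExcess-even 1≤k 2j+2<m)
... | even j with m≤n⇒m<n∨m≡n (s≤s⁻¹ g<m)
...   | inj₁ 2j<2k = λ eq → TwoOrThree⇒≢1 (neighbourExcess-even 1≤k g<m) (trans eq D-next)
  where
  D-next = trans (cong (neighbourExcess (suc (double k))) (next-inner (s≤s 2j<2k)))
                 (neighbourExcess-odd (s≤s 2j<2k))
...   | inj₂ 2j≡2k = subst (λ g → D g ≢ D (next (suc (double k)) g)) (sym 2j≡2k) last
  where
  D = neighbourExcess (suc (double k))
  last : D (double k) ≢ D (next (suc (double k)) (double k))
  last eq with trans eq (cong D (next-last {suc (double k)} {double k} refl)) | neighbourExcess-ends 1≤k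
  ... | Dₗ≡D₀ | inj₁ (D₀ , Dₗ) = contradiction (trans (sym Dₗ) (trans Dₗ≡D₀ D₀)) λ ()
  ... | Dₗ≡D₀ | inj₂ (D₀ , Dₗ) = contradiction (trans (sym Dₗ) (trans Dₗ≡D₀ D₀)) λ ()

-- Upper bound

module PerturbedKotzigLabeling (k r : ℕ) (1≤k : 1 ≤ k) where

  private
    m n : ℕ
    m = suc (double k)
    n = suc (suc r)
    3≤m : 3 ≤ m
    3≤m = s≤s (double-mono-≤ 1≤k)

  open KotzigArray (kotzigArray k r)

  rows : ℕ → ℕ → ℕ
  rows = consRow swapMod4 row

  open RowLabeling {m} {n} 3≤m rows (consRow-permutes (swapMod4-permutes k) row-permutes) public

  A : Fin (m * n) → Fin (m * n) → Bool
  A = cycleLexEmpty m n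

  D : ℕ → ℕ
  D = neighbourExcess m

  offset : ℕ
  offset = ∑[ h < n ] suc (h * m) + colSum

  layerSum-excess : ∀ {g} → g < m → layerSum g + 1 ≡ offset + excess g
  layerSum-excess {g} g<m = +-cancelʳ-≡ g _ _ (begin
    layerSum g + 1 + g
      ≡⟨ cong (λ s → s + 1 + g) (∑-distrib-+ n (λ h → suc (h * m)) (λ h → rows h g)) ⟩
    base + (swapMod4 g + kotzig) + 1 + g
      ≡⟨ regroup base (swapMod4 g) kotzig g ⟩
    base + (g + kotzig) + (swapMod4 g + 1)
      ≡⟨ cong₂ (λ s t → base + s + t) (colSum-eq g<m) (swapMod4-excess g) ⟩
    offset + (g + excess g)
      ≡⟨ cong (offset +_) (+-comm g (excess g)) ⟩
    offset + (excess g + g)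
      ≡⟨ +-assoc offset (excess g) g ⟨
    offset + excess g + g ∎)
    where
    open ≡-Reasoning
    base kotzig : ℕ
    base = ∑[ h < n ] suc (h * m)
    kotzig = ∑[ h < suc r ] row h g
    regroup : ∀ b s t g → b + (s + t) + 1 + g ≡ b + (g + t) + (s + 1)
    regroup = solve-∀

  layer : Fin (m * n) → ℕ
  layer u = toℕ u / n

  layer-< : ∀ u → layer u < m
  layer-< u = m<n*o⇒m/o<n (toℕ<n u)

  weight-excess : ∀ u → weight A labeling u + 2 ≡ (offset + offset) + D (layer u)
  weight-excess u = begin
    weight A labeling u + 2                    ≡⟨ cong (_+ 2) (weight-layerSum u) ⟩
    layerSum p + layerSum q + 2                ≡⟨ regroup (layerSum p) (layerSum q) ⟩
    (layerSum p + 1) + (layerSum q + 1)        ≡⟨ cong₂ _+_ (layerSum-excess (prev-< a<m)) (layerSum-excess (next-< a<m)) ⟩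
    (offset + excess p) + (offset + excess q)  ≡⟨ interchange offset (excess p) offset (excess q) ⟩
    (offset + offset) + D (layer u)            ∎
    where
    open ≡-Reasoning
    a<m : layer u < m
    a<m = layer-< u
    p q : ℕ
    p = prev m (layer u)
    q = next m (layer u)
    regroup : ∀ a b → a + b + 2 ≡ (a + 1) + (b + 1)
    regroup = solve-∀
    interchange : ∀ a b c d → (a + b) + (c + d) ≡ (a + c) + (b + d)
    interchange = solve-∀

  same-weight⇒same-excess : ∀ {u v} → weight A labeling u ≡ weight A labeling v → D (layer u) ≡ D (layer v)
  same-weight⇒same-excess {u} {v} eq =
    +-cancelˡ-≡ (offset + offset) _ _ (trans (sym (weight-excess u)) (trans (cong (_+ 2) eq) (weight-excess v)))

  same-excess⇒same-weight : ∀ {u v} → D (layer u) ≡ D (layer v) → weight A labeling u ≡ weight A labeling v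
  same-excess⇒same-weight {u} {v} eq =
    +-cancelʳ-≡ 2 _ _ (trans (weight-excess u) (trans (cong (offset + offset +_) eq) (sym (weight-excess v))))

  isLDA : IsLDA A labeling
  isLDA u v adj same-weight with adjacent⇒neighbour (layer-< v) (trans (sym (cycleLexEmpty-layers m n u v)) adj)
  ... | inj₂ v≡next = neighbourExcess-proper {k} 1≤k (layer-< u) (trans same-excess (cong D v≡next))
    where
    same-excess : D (layer u) ≡ D (layer v)
    same-excess = same-weight⇒same-excess {u} {v} same-weight
  ... | inj₁ v≡prev = neighbourExcess-proper {k} 1≤k (layer-< v) (trans (sym same-excess) (cong D u≡next))
    where
    same-excess : D (layer u) ≡ D (layer v)
    same-excess = same-weight⇒same-excess {u} {v} same-weight
    u≡next : layer u ≡ next m (layer v)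
    u≡next = trans (sym (next-prev (layer-< u))) (cong (next m) (sym v≡prev))

  repWeight : ℕ → ℕ
  repWeight g = weight A labeling (layerRep {m} {n} g)

  D-layerRep : ∀ {g} → g < m → D (layer (layerRep {m} {n} g)) ≡ D g
  D-layerRep g<m = cong D (layerRep-layer g<m)

  weight-by-excess : ∀ u {g} → g < m → D (layer u) ≡ D g → weight A labeling u ≡ repWeight g
  weight-by-excess u {g} g<m eq = same-excess⇒same-weight {u} {layerRep {m} {n} g} (trans eq (sym (D-layerRep g<m)))

  repWeight-distinct : ∀ {g g′} → g < m → g′ < m → D g ≢ D g′ → repWeight g ≢ repWeight g′
  repWeight-distinct {g} {g′} g<m g′<m D≢ eq = D≢ (begin
    D g                             ≡⟨ D-layerRep g<m ⟨
    D (layer (layerRep {m} {n} g))  ≡⟨ same-weight⇒same-excess {layerRep {m} {n} g} {layerRep {m} {n} g′} eq ⟩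
    D (layer (layerRep {m} {n} g′)) ≡⟨ D-layerRep g′<m ⟩
    D g′                            ∎)
    where open ≡-Reasoning

  1<m : 1 < m
  1<m = ≤-trans (s≤s (s≤s z≤n)) 3≤m

  D1≡1 : D 1 ≡ 1
  D1≡1 = neighbourExcess-odd {k} {0} 1<m

  weight-classes : ∀ u → OneOf₃ (repWeight 1) (repWeight 0) (repWeight (double k)) (weight A labeling u)
  weight-classes u with neighbourExcess-values 1≤k (layer-< u) | neighbourExcess-ends 1≤k
  ... | inj₁ Du≡1        | _             = inj₁ (weight-by-excess u 1<m (trans Du≡1 (sym D1≡1)))
  ... | inj₂ (inj₁ Du≡2) | inj₁ (D₀ , _) = inj₂ (inj₁ (weight-by-excess u z<s (trans Du≡2 (sym D₀))))
  ... | inj₂ (inj₂ Du≡3) | inj₁ (_ , Dₗ) = inj₂ (inj₂ (weight-by-excess u (n<1+n _) (trans Du≡3 (sym Dₗ))))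
  ... | inj₂ (inj₁ Du≡2) | inj₂ (_ , Dₗ) = inj₂ (inj₂ (weight-by-excess u (n<1+n _) (trans Du≡2 (sym Dₗ))))
  ... | inj₂ (inj₂ Du≡3) | inj₂ (D₀ , _) = inj₂ (inj₁ (weight-by-excess u z<s (trans Du≡3 (sym D₀))))

  numWeights≡3 : numWeights A labeling ≡ 3
  numWeights≡3 = ≤-antisym
    (length-deduplicate-≤3 weights (map⁺ {f = weight A labeling} (tabulate⁺ {f = λ u → u} weight-classes)))
    (length-deduplicate-≥3 weights
      (repWeight-distinct 1<m z<s (λ eq → TwoOrThree⇒≢1 D₀∈ (trans (sym eq) D1≡1)))
      (repWeight-distinct 1<m (n<1+n _) (λ eq → TwoOrThree⇒≢1 Dₗ∈ (trans (sym eq) D1≡1)))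
      (repWeight-distinct z<s (n<1+n _) ends-distinct)
      (listed 1) (listed 0) (listed (double k)))
    where
    weights = map (weight A labeling) (allFin (m * n))
    listed : ∀ g → repWeight g ∈ weights
    listed g = ∈-map⁺ (weight A labeling) (∈-allFin (layerRep {m} {n} g))
    D₀∈ : TwoOrThree (D 0)
    D₀∈ = neighbourExcess-even {k} {0} 1≤k z<s
    Dₗ∈ : TwoOrThree (D (double k))
    Dₗ∈ = neighbourExcess-even {k} {k} 1≤k (n<1+n _)
    ends-distinct : D 0 ≢ D (double k)
    ends-distinct with neighbourExcess-ends 1≤k
    ... | inj₁ (D₀ , Dₗ) = λ eq → contradiction (trans (sym D₀) (trans eq Dₗ)) λ ()
    ... | inj₂ (D₀ , Dₗ) = λ eq → contradiction (trans (sym D₀) (trans eq Dₗ)) λ ()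

chiLd-cycleLexEmpty : ∀ k r → 1 ≤ k → ChiLdEq (cycleLexEmpty (suc (double k)) (suc (suc r))) 3
chiLd-cycleLexEmpty k r 1≤k = (labeling , isLDA , numWeights≡3) , chiLd-lower {k} 1≤k
  where open PerturbedKotzigLabeling k r 1≤k

odd⇒suc-double : ∀ {m} → m % 2 ≡ 1 → m ≡ suc (double (m / 2))
odd⇒suc-double {m} m%2≡1 = trans (m≡m%n+[m/n]*n m 2) (cong₂ _+_ m%2≡1 (n*2≡double (m / 2)))

mainTheorem16 : (m n : ℕ) → 5 ≤ m → m % 2 ≡ 1 → 3 ≤ n
    → ChiLdEq (cycleLexEmpty m n) 3
mainTheorem16 m (suc (suc r)) 5≤m m-odd _ =
  subst (λ m → ChiLdEq (cycleLexEmpty m (suc (suc r))) 3) (sym (odd⇒suc-double {m} m-odd))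
    (chiLd-cycleLexEmpty (m / 2) r (m≥n⇒m/n>0 (≤-trans (s≤s (s≤s z≤n)) 5≤m)))
mainTheorem16 m 1 _ _ (s≤s ())
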